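{- Let $n\geq 4$ and let $H_n$ be the graph with vertex set $\{v_{i,j} : i\in\{0,\dots,n-1\},\ j\in\mathbb Z_3\}$ in which $v_{i,j}v_{i,j'}$ is an edge for all $i$ and $j\neq j'$, $v_{i,j}v_{i+1,j}$ is an edge for $0\leq i\leq n-2$, and $v_{0,j}v_{n-1,-j}$ is an edge for all $j\in\mathbb Z_3$ (no other edges). Let $C_i=\{v_{i,j}: j\in\mathbb Z_3\}$ and $R_j=\{v_{i,j}: 0\le i\le n-1\}$. Say a set $U\subseteq V(H_n)$ satisfies (a) if $|U\cap C_i|\geq 2$ for some $i$; (b) if $U$ contains at least $n-1$ vertices of $R_0$ and $n$ is odd; (c) if the subgraph of $H_n$ induced on $U\setminus R_0$ contains a path with at least $n$ vertices and $n$ is even. If $W\subseteq V(H_n)$ satisfies none of (a)–(c), then there is a set $Z$ with $W\subseteq Z\subseteq V(H_n)$ such that $|Z\cap C_i|=1$ for every $i\in\{0,\dots,n-1\}$ and $Z$ satisfies none of (a)–(c). -}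

module Defs where

open import Data.Nat using (ℕ; zero; suc; _+_; _∸_; _≤_; _%_)
open import Data.Fin using (Fin; zero; suc; toℕ)
open import Data.Bool using (Bool; true; false; if_then_else_)
open import Data.Product using (_×_; Σ; ∃; ∃-syntax; _,_)
open import Data.Sum using (_⊎_)
open import Data.List using (List; length)
open import Data.List.Relation.Unary.All using (All)
open import Data.List.Relation.Unary.Unique.Propositional using (Unique)
open import Data.List.Relation.Unary.Linked using (Linked)
open import Relation.Binary.PropositionalEquality using (_≡_; _≢_)
open import Relation.Nullary using (¬_)

-- Vertex v_{i,j} of H_n is the pair (i , j) with i : Fin n, j : Fin 3 (= ℤ₃).
Vertex : ℕ → Set
Vertex n = Fin n × Fin 3

neg3 : Fin 3 → Fin 3
neg3 zero = zero
neg3 (suc zero) = suc (suc zero)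
neg3 (suc (suc zero)) = suc zero

-- Edges of H_n (as a symmetric relation).
data Adj (n : ℕ) : Vertex n → Vertex n → Set where
  column : ∀ i j j' → j ≢ j' → Adj n (i , j) (i , j')
  rowFwd : ∀ i i' j → toℕ i' ≡ suc (toℕ i) → Adj n (i , j) (i' , j)
  rowBwd : ∀ i i' j → toℕ i ≡ suc (toℕ i') → Adj n (i , j) (i' , j)
  wrapFwd : ∀ i i' j → toℕ i ≡ 0 → toℕ i' ≡ n ∸ 1 → Adj n (i , j) (i' , neg3 j)
  wrapBwd : ∀ i i' j → toℕ i ≡ n ∸ 1 → toℕ i' ≡ 0 → Adj n (i , neg3 j) (i' , j)

VSet : ℕ → Set
VSet n = Fin n → Fin 3 → Bool

count : ∀ {k} → (Fin k → Bool) → ℕ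
count {zero} f = 0
count {suc k} f = (if f zero then 1 else 0) + count (λ x → f (suc x))

colCount : ∀ {n} → VSet n → Fin n → ℕ
colCount U i = count (U i)

row0Count : ∀ {n} → VSet n → ℕ
row0Count U = count (λ i → U i zero)

_∈V_ : ∀ {n} → Vertex n → VSet n → Set
(i , j) ∈V U = U i j ≡ true

InUMinusR0 : ∀ {n} → VSet n → Vertex n → Set
InUMinusR0 U (i , j) = (U i j ≡ true) × (j ≢ zero)

IsPathIn : ∀ {n} → (Vertex n → Set) → List (Vertex n) → Set
IsPathIn {n} S p = Unique p × All S p × Linked (Adj n) p

CondA : ∀ {n} → VSet n → Set
CondA U = ∃[ i ] 2 ≤ colCount U i

CondB : ∀ {n} → VSet n → Set
CondB {n} U = (n ∸ 1 ≤ row0Count U) × (n % 2 ≡ 1)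

CondC : ∀ {n} → VSet n → Set
CondC {n} U = (∃[ p ] (IsPathIn (InUMinusR0 U) p × n ≤ length p)) × (n % 2 ≡ 0)

SatisfiesNone : ∀ {n} → VSet n → Set
SatisfiesNone U = ¬ CondA U × ¬ CondB U × ¬ CondC U

module Submission where

open import Defs
import Data.Nat as ℕ
open import Data.Nat using (ℕ; suc; _≤_; _∸_; _%_; z≤n; s≤s)
open import Data.Fin using (Fin; zero; suc; _≟_)
open import Data.Bool using (Bool; true; false; not; _∧_; _∨_)
open import Data.Bool.Properties using (∧-zeroʳ; ∨-identityʳ)
open import Data.Product using (_×_; ∃-syntax; _,_)
open import Data.Empty using (⊥-elim)
open import Data.List.Relation.Unary.All using (map)
open import Function using (_∘_)
open import Relation.Nullary using (¬_; yes; no; does)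
open import Relation.Nullary.Decidable using (dec-false)
open import Relation.Binary.PropositionalEquality
  using (_≡_; _≢_; refl; sym; trans; cong; subst)

-- Z adds a fixed vertex v_{i,c} to every column C_i that W misses. For even n take c = 0:
-- then Z ∖ R₀ = W ∖ R₀, so (c) is inherited from W and (b) fails by parity. For odd n take
-- c ≠ 0: then Z ∩ R₀ = W ∩ R₀, so (b) is inherited from W and (c) fails by parity.

count-cong : ∀ {k} {f g : Fin k → Bool} → (∀ x → f x ≡ g x) → count f ≡ count g
count-cong {ℕ.zero}  f≗g = refl
count-cong {suc k} f≗g rewrite f≗g zero = cong (_ ℕ.+_) (count-cong (λ x → f≗g (suc x)))

isEmpty : (Fin 3 → Bool) → Bool
isEmpty f = not (f zero ∨ f (suc zero) ∨ f (suc (suc zero)))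

complete : Fin 3 → (Fin 3 → Bool) → Fin 3 → Bool
complete c f j = f j ∨ (isEmpty f ∧ does (j ≟ c))

⊆-complete : ∀ c f {j} → f j ≡ true → complete c f j ≡ true
⊆-complete c f fj≡true rewrite fj≡true = refl

complete-≢ : ∀ c f {j} → j ≢ c → complete c f j ≡ f j
complete-≢ c f {j} j≢c
  rewrite dec-false (j ≟ c) j≢c | ∧-zeroʳ (isEmpty f) = ∨-identityʳ (f j)

count-complete : ∀ c f → ¬ 2 ≤ count f → count (complete c f) ≡ 1
count-complete c f count≰1 with f zero | f (suc zero) | f (suc (suc zero))
count-complete zero             f _ | false | false | false = refl
count-complete (suc zero)       f _ | false | false | false = refl
count-complete (suc (suc zero)) f _ | false | false | false = refl
count-complete c f _        | true  | false | false = refl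
count-complete c f _        | false | true  | false = refl
count-complete c f _        | false | false | true  = refl
count-complete c f count≰1 | true  | true  | _     = ⊥-elim (count≰1 (s≤s (s≤s z≤n)))
count-complete c f count≰1 | true  | false | true  = ⊥-elim (count≰1 (s≤s (s≤s z≤n)))
count-complete c f count≰1 | false | true  | true  = ⊥-elim (count≰1 (s≤s (s≤s z≤n)))

completeColumns : ∀ {n} → Fin 3 → VSet n → VSet n
completeColumns c W i = complete c (W i)

¬CondA-if-colCount≡1 : ∀ {n} {Z : VSet n} → (∀ i → colCount Z i ≡ 1) → ¬ CondA Z
¬CondA-if-colCount≡1 colCount≡1 (i , 2≤colCount)
  with s≤s () ← subst (2 ≤_) (colCount≡1 i) 2≤colCount

¬CondB-if-even : ∀ {n} {U : VSet n} → n % 2 ≡ 0 → ¬ CondB U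
¬CondB-if-even even (_ , odd) with trans (sym even) odd
... | ()

¬CondC-if-odd : ∀ {n} {U : VSet n} → n % 2 ≢ 0 → ¬ CondC U
¬CondC-if-odd odd (_ , even) = odd even

CondB-cong-row0 : ∀ {n} {U V : VSet n} → (∀ i → U i zero ≡ V i zero) → CondB U → CondB V
CondB-cong-row0 {n} U≗V (n∸1≤count , odd) =
  subst (n ∸ 1 ≤_) (count-cong U≗V) n∸1≤count , odd

CondC-cong-off-row0 : ∀ {n} {U V : VSet n} → (∀ i j → j ≢ zero → U i j ≡ V i j) →
  CondC U → CondC V
CondC-cong-off-row0 {U = U} {V} U≗V ((p , (unique , inU , linked) , n≤length) , even) =
  (p , (unique , map inV inU , linked) , n≤length) , even
  where
  inV : ∀ {v} → InUMinusR0 U v → InUMinusR0 V v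
  inV {i , j} (Uij , j≢0) = trans (sym (U≗V i j j≢0)) Uij , j≢0

¬CondB-completeColumns : ∀ {n} c (W : VSet n) → c ≢ zero →
  ¬ CondB W → ¬ CondB (completeColumns c W)
¬CondB-completeColumns c W c≢0 ¬b =
  ¬b ∘ CondB-cong-row0 {U = completeColumns c W} {V = W}
         (λ i → complete-≢ c (W i) (c≢0 ∘ sym))

¬CondC-completeColumns-zero : ∀ {n} (W : VSet n) →
  ¬ CondC W → ¬ CondC (completeColumns zero W)
¬CondC-completeColumns-zero W ¬c =
  ¬c ∘ CondC-cong-off-row0 {U = completeColumns zero W} {V = W}
         (λ i j j≢0 → complete-≢ zero (W i) j≢0)

completeColumns-extends : ∀ {n} c (W : VSet n) → ¬ CondA W →
  ¬ CondB (completeColumns c W) → ¬ CondC (completeColumns c W) →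
  ∃[ Z ] ((∀ i j → W i j ≡ true → Z i j ≡ true) × (∀ i → colCount Z i ≡ 1) × SatisfiesNone Z)
completeColumns-extends c W ¬a ¬b ¬c =
  completeColumns c W , (λ i j → ⊆-complete c (W i)) , colCount≡1 ,
  ¬CondA-if-colCount≡1 {Z = completeColumns c W} colCount≡1 , ¬b , ¬c
  where
  colCount≡1 : ∀ i → colCount (completeColumns c W) i ≡ 1
  colCount≡1 i = count-complete c (W i) (λ 2≤colCount → ¬a (i , 2≤colCount))

lemma2p3 : (n : ℕ) → 4 ≤ n → (W : VSet n) → SatisfiesNone W →
    ∃[ Z ] ((∀ i j → W i j ≡ true → Z i j ≡ true) × (∀ i → colCount Z i ≡ 1) × SatisfiesNone Z)
lemma2p3 n _ W (¬a , ¬b , ¬c) with n % 2 ℕ.≟ 0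
... | yes even = completeColumns-extends zero W ¬a
  (¬CondB-if-even {U = completeColumns zero W} even)
  (¬CondC-completeColumns-zero W ¬c)
... | no odd = completeColumns-extends (suc zero) W ¬a
  (¬CondB-completeColumns (suc zero) W (λ ()) ¬b)
  (¬CondC-if-odd {U = completeColumns (suc zero) W} odd)
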